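{- Let $a,b\in Ag$ with $a\neq b$. There exist formulas $\varphi\in\mathrm{Fm}_{\mathsf S}$ such that (1) $\not\vdash_{\mathsf S}S_{a,b}\varphi\to\neg S_{b,a}\varphi$, and there exist formulas $\varphi$ such that (2) $\not\vdash_{\mathsf S}S_{a,b}\varphi\to\neg K_b\varphi$.
   Context: Let $Ag$ be a non-empty finite set of agents (with at least two elements) and $Var$ a countably infinite set of propositional variables. The formulas $\mathrm{Fm}_{\mathsf S}$ are generated by $\varphi::=p\mid\neg\varphi\mid\varphi\land\varphi\mid I_a\varphi\mid K_a\varphi\mid B_a\varphi$ ($p\in Var$, $a\in Ag$), with $\lor,\to$ classical abbreviations. The logic $\mathsf S$ ($\vdash_{\mathsf S}\varphi$ means $\varphi$ is derivable) has as axioms: all classical tautologies; for each $a$ and $\star\in\{K_a,B_a,I_a\}$, $\star(\varphi\to\psi)\to(\star\varphi\to\star\psi)$; $K_a\varphi\to\varphi$; $K_a\varphi\to K_aK_a\varphi$; $B_a\varphi\to\neg B_a\neg\varphi$; $K_a\varphi\to B_a\varphi$; $B_a\varphi\to K_aB_a\varphi$; $I_a\varphi\to\neg I_a\neg\varphi$; $I_a\varphi\to K_aI_a\varphi$; $I_a\varphi\to I_aK_a\varphi$; $I_a\varphi\to I_aI_a\varphi$; rules: modus ponens and necessitation for each $K_a,B_a,I_a$. For agents $a,b$, $S_{a,b}\varphi:=K_a\varphi\land B_a\neg K_b\varphi\land I_a(\varphi\land\neg K_b\varphi)$. -}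

module Defs where

open import Data.Nat using (ℕ)
open import Data.Fin using (Fin)
open import Data.Bool using (Bool; true; false; not; _∧_)
open import Relation.Binary.PropositionalEquality using (_≡_)

data Fm (n : ℕ) : Set where
  var  : ℕ → Fm n
  ¬'_  : Fm n → Fm n
  _∧'_ : Fm n → Fm n → Fm n
  I    : Fin n → Fm n → Fm n
  K    : Fin n → Fm n → Fm n
  B    : Fin n → Fm n → Fm n

infixr 6 _∧'_
infixr 4 _⇒_
infixl 5 _∨'_

_∨'_ : ∀ {n} → Fm n → Fm n → Fm n
φ ∨' ψ = ¬' ((¬' φ) ∧' (¬' ψ))

_⇒_ : ∀ {n} → Fm n → Fm n → Fm n
φ ⇒ ψ = ¬' (φ ∧' (¬' ψ))

⟦_⟧ : ∀ {n} → Fm n → (Fm n → Bool) → Bool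
⟦ var p ⟧ v = v (var p)
⟦ ¬' φ ⟧ v = not (⟦ φ ⟧ v)
⟦ φ ∧' ψ ⟧ v = ⟦ φ ⟧ v ∧ ⟦ ψ ⟧ v
⟦ I a φ ⟧ v = v (I a φ)
⟦ K a φ ⟧ v = v (K a φ)
⟦ B a φ ⟧ v = v (B a φ)

-- Classical tautology (instance of a propositional tautology).
Taut : ∀ {n} → Fm n → Set
Taut φ = ∀ v → ⟦ φ ⟧ v ≡ true

data ⊢S {n : ℕ} : Fm n → Set where
  taut   : ∀ {φ} → Taut φ → ⊢S φ
  K-distK : ∀ a φ ψ → ⊢S (K a (φ ⇒ ψ) ⇒ (K a φ ⇒ K a ψ))
  K-distB : ∀ a φ ψ → ⊢S (B a (φ ⇒ ψ) ⇒ (B a φ ⇒ B a ψ))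
  K-distI : ∀ a φ ψ → ⊢S (I a (φ ⇒ ψ) ⇒ (I a φ ⇒ I a ψ))
  T-K    : ∀ a φ → ⊢S (K a φ ⇒ φ)
  4-K    : ∀ a φ → ⊢S (K a φ ⇒ K a (K a φ))
  D-B    : ∀ a φ → ⊢S (B a φ ⇒ ¬' (B a (¬' φ)))
  KB     : ∀ a φ → ⊢S (K a φ ⇒ B a φ)
  BKB    : ∀ a φ → ⊢S (B a φ ⇒ K a (B a φ))
  D-I    : ∀ a φ → ⊢S (I a φ ⇒ ¬' (I a (¬' φ)))
  IKI    : ∀ a φ → ⊢S (I a φ ⇒ K a (I a φ))
  IIK    : ∀ a φ → ⊢S (I a φ ⇒ I a (K a φ))
  4-I    : ∀ a φ → ⊢S (I a φ ⇒ I a (I a φ))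
  mp     : ∀ {φ ψ} → ⊢S (φ ⇒ ψ) → ⊢S φ → ⊢S ψ
  nec-K  : ∀ a {φ} → ⊢S φ → ⊢S (K a φ)
  nec-B  : ∀ a {φ} → ⊢S φ → ⊢S (B a φ)
  nec-I  : ∀ a {φ} → ⊢S φ → ⊢S (I a φ)

S : ∀ {n} → Fin n → Fin n → Fm n → Fm n
S a b φ = K a φ ∧' (B a (¬' (K b φ)) ∧' I a (φ ∧' ¬' (K b φ)))

{-# OPTIONS --safe #-}
-- S is sound for finite Kripke models in which each agent's knowledge relation is a
-- preorder, belief and intention are serial, belief is contained in knowledge, and
-- the frame conditions matching B → KB, I → KI, I → IK and I → II hold. So it is
-- enough to find one such model with a world where both S_{a,b} p and S_{b,a} p
-- hold. In the four-world model below both agents know p at world 0, but a's only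
-- doxastic alternative is world 1, from which b considers the ¬p-world 3 possible,
-- and symmetrically b's only alternative is world 2, from which a sees world 3.
module Submission where

open import Defs
open import Data.Bool using (Bool; true; false; T; not; _∧_; if_then_else_)
open import Data.Bool.Properties using (T?; T-≡)
open import Data.Fin using (Fin; _≟_)
open import Data.Fin.Patterns using (0F; 1F; 2F; 3F)
open import Data.Fin.Properties using (all?; any?)
open import Data.Nat using (ℕ; _≥_)
open import Data.Product using (_×_; ∃; _,_; proj₁; proj₂)
open import Function using (_∘_; _∘₂_)
open import Function.Bundles using (Equivalence)
open import Level using (Level; 0ℓ; _⊔_)
open import Relation.Binary.Core using (Rel) renaming (_⇒_ to _⊆_)
open import Relation.Binary.Definitions using (Reflexive; Transitive; Trans; Decidable)
open import Relation.Binary.PropositionalEquality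
  using (_≡_; _≢_; refl; sym; cong; cong₂; subst₂; module ≡-Reasoning)
open import Relation.Nullary using (¬_; Dec; does; isYes)
open import Relation.Nullary.Decidable
  using (isYes≗does; dec-true; dec-false; map′; ¬?; _×-dec_; _→-dec_; toWitness; from-yes; decidable-stable)
open import Relation.Unary using (Pred; ∁)
import Relation.Unary as U

private
  variable
    ℓ₀ ℓ ℓ′ : Level
    A : Set ℓ₀
    R R′ R″ : Rel A ℓ
    P : Pred A ℓ′
    x : A
    n k m : ℕ

Serial : Rel A ℓ → Set _
Serial R = ∀ x → ∃ (R x)

-- A record rather than a Π-type, so that R, P and x are recovered by unification.
record □ {A : Set ℓ₀} (R : Rel A ℓ) (P : Pred A ℓ′) (x : A) : Set (ℓ₀ ⊔ ℓ ⊔ ℓ′) where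
  constructor box
  field unbox : ∀ {y} → R x y → P y
open □

□-antitone : R ⊆ R′ → □ R′ P x → □ R P x
□-antitone R⊆R′ h = box λ r → unbox h (R⊆R′ r)

□-refl : Reflexive R → □ R P x → P x
□-refl R-refl h = unbox h R-refl

□-serial : Serial R → □ R P x → ¬ □ R (∁ P) x
□-serial {x = x} serial h h′ = let _ , r = serial x in unbox h′ r (unbox h r)

□-trans : Trans R R′ R″ → □ R″ P x → □ R (□ R′ P) x
□-trans tr h = box λ r → box λ r′ → unbox h (tr r r′)

□? : {R : Rel (Fin m) ℓ} {P : Pred (Fin m) ℓ′} → Decidable R → U.Decidable P → U.Decidable (□ R P)
□? R? P? x = map′ (λ h → box (h _)) (λ h y → unbox h {y}) (all? λ y → R? x y →-dec P? y)

reflexive? : {R : Rel (Fin m) ℓ} → Decidable R → Dec (Reflexive R)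
reflexive? R? =
  map′ (λ h {x} → h x) (λ h x → h) (all? λ x → R? x x)

serial? : {R : Rel (Fin m) ℓ} → Decidable R → Dec (Serial R)
serial? R? = all? λ x → any? (R? x)

⊆? : {R R′ : Rel (Fin m) ℓ} → Decidable R → Decidable R′ → Dec (R ⊆ R′)
⊆? R? R′? =
  map′ (λ h {x y} → h x y) (λ h x y → h) (all? λ x → all? λ y → R? x y →-dec R′? x y)

trans? : {R R′ R″ : Rel (Fin m) ℓ} → Decidable R → Decidable R′ → Decidable R″ → Dec (Trans R R′ R″)
trans? R? R′? R″? =
  map′ (λ h {x y z} → h x y z) (λ h x y z → h)
       (all? λ x → all? λ y → all? λ z → R? x y →-dec R′? y z →-dec R″? x z)

record Model (agents worlds : ℕ) : Set₁ where
  field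
    K[_] B[_] I[_] : Fin agents → Rel (Fin worlds) 0ℓ
    K? : ∀ a → Decidable K[ a ]
    B? : ∀ a → Decidable B[ a ]
    I? : ∀ a → Decidable I[ a ]
    valuation : ℕ → Fin worlds → Bool

record IsSModel (M : Model n m) : Set where
  open Model M
  field
    K-refl    : ∀ a → Reflexive K[ a ]
    K-trans   : ∀ a → Transitive K[ a ]
    B-serial  : ∀ a → Serial B[ a ]
    B⊆K       : ∀ a → B[ a ] ⊆ K[ a ]
    K-B-trans : ∀ a → Trans K[ a ] B[ a ] B[ a ]
    I-serial  : ∀ a → Serial I[ a ]
    K-I-trans : ∀ a → Trans K[ a ] I[ a ] I[ a ]
    I-K-trans : ∀ a → Trans I[ a ] K[ a ] I[ a ]
    I-trans   : ∀ a → Transitive I[ a ]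

module Semantics (M : Model n m) where
  open Model M

  infix 4 _⊩_ _⊩?_

  _⊩_ : Fin m → Fm n → Set
  w ⊩ var p    = T (valuation p w)
  w ⊩ ¬' φ     = ¬ w ⊩ φ
  w ⊩ φ ∧' ψ   = w ⊩ φ × w ⊩ ψ
  w ⊩ I a φ    = □ I[ a ] (_⊩ φ) w
  w ⊩ K a φ    = □ K[ a ] (_⊩ φ) w
  w ⊩ B a φ    = □ B[ a ] (_⊩ φ) w

  _⊩?_ : ∀ w φ → Dec (w ⊩ φ)
  w ⊩? var p   = T? (valuation p w)
  w ⊩? ¬' φ    = ¬? (w ⊩? φ)
  w ⊩? φ ∧' ψ  = (w ⊩? φ) ×-dec (w ⊩? ψ)
  w ⊩? I a φ   = □? (I? a) (_⊩? φ) w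
  w ⊩? K a φ   = □? (K? a) (_⊩? φ) w
  w ⊩? B a φ   = □? (B? a) (_⊩? φ) w

  ⟦⟧≡does-⊩? : ∀ w φ → ⟦ φ ⟧ (does ∘ (w ⊩?_)) ≡ does (w ⊩? φ)
  ⟦⟧≡does-⊩? w (var p)  = refl
  ⟦⟧≡does-⊩? w (¬' φ)   = cong not (⟦⟧≡does-⊩? w φ)
  ⟦⟧≡does-⊩? w (φ ∧' ψ) = cong₂ _∧_ (⟦⟧≡does-⊩? w φ) (⟦⟧≡does-⊩? w ψ)
  ⟦⟧≡does-⊩? w (I a φ)  = refl
  ⟦⟧≡does-⊩? w (K a φ)  = refl
  ⟦⟧≡does-⊩? w (B a φ)  = refl

  ⊩-taut : ∀ φ → Taut φ → ∀ w → w ⊩ φ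
  ⊩-taut φ t w = toWitness {a? = w ⊩? φ} (Equivalence.from T-≡ (begin
    isYes (w ⊩? φ)             ≡⟨ isYes≗does (w ⊩? φ) ⟩
    does (w ⊩? φ)              ≡⟨ ⟦⟧≡does-⊩? w φ ⟨
    ⟦ φ ⟧ (does ∘ (w ⊩?_))     ≡⟨ t _ ⟩
    true                       ∎))
    where open ≡-Reasoning

  ⊩-mp : ∀ {w} φ ψ → w ⊩ (φ ⇒ ψ) → w ⊩ φ → w ⊩ ψ
  ⊩-mp {w} _ ψ h p = decidable-stable (w ⊩? ψ) (λ ¬q → h (p , ¬q))

  ⊩-□-mp : ∀ {R : Rel (Fin m) 0ℓ} {w} φ ψ → □ R (_⊩ (φ ⇒ ψ)) w → □ R (_⊩ φ) w → □ R (_⊩ ψ) w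
  ⊩-□-mp φ ψ f g = box λ r → ⊩-mp φ ψ (unbox f r) (unbox g r)

module Soundness {M : Model n m} (isS : IsSModel M) where
  open Semantics M
  open IsSModel isS

  ⊩-sound : ∀ {φ} → ⊢S φ → ∀ w → w ⊩ φ
  ⊩-sound (taut {φ} t)               = ⊩-taut φ t
  ⊩-sound (K-distK a φ ψ) w (f , ¬c) = ¬c λ (g , ¬h) → ¬h (⊩-□-mp φ ψ f g)
  ⊩-sound (K-distB a φ ψ) w (f , ¬c) = ¬c λ (g , ¬h) → ¬h (⊩-□-mp φ ψ f g)
  ⊩-sound (K-distI a φ ψ) w (f , ¬c) = ¬c λ (g , ¬h) → ¬h (⊩-□-mp φ ψ f g)
  ⊩-sound (T-K a φ) w (h , ¬c)       = ¬c (□-refl (K-refl a) h)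
  ⊩-sound (4-K a φ) w (h , ¬c)       = ¬c (□-trans (K-trans a) h)
  ⊩-sound (D-B a φ) w (h , ¬c)       = ¬c (□-serial (B-serial a) h)
  ⊩-sound (KB a φ) w (h , ¬c)        = ¬c (□-antitone (B⊆K a) h)
  ⊩-sound (BKB a φ) w (h , ¬c)       = ¬c (□-trans (K-B-trans a) h)
  ⊩-sound (D-I a φ) w (h , ¬c)       = ¬c (□-serial (I-serial a) h)
  ⊩-sound (IKI a φ) w (h , ¬c)       = ¬c (□-trans (K-I-trans a) h)
  ⊩-sound (IIK a φ) w (h , ¬c)       = ¬c (□-trans (I-K-trans a) h)
  ⊩-sound (4-I a φ) w (h , ¬c)       = ¬c (□-trans (I-trans a) h)
  ⊩-sound (mp {φ} {ψ} d e) w        = ⊩-mp φ ψ (⊩-sound d w) (⊩-sound e w)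
  ⊩-sound (nec-K a d) w              = box λ {v} _ → ⊩-sound d v
  ⊩-sound (nec-B a d) w              = box λ {v} _ → ⊩-sound d v
  ⊩-sound (nec-I a d) w              = box λ {v} _ → ⊩-sound d v

  ⊬-⇒¬ : ∀ {w φ ψ} → w ⊩ φ → w ⊩ ψ → ¬ ⊢S (φ ⇒ ¬' ψ)
  ⊬-⇒¬ {w} p q d = ⊩-sound d w (p , λ ¬q → ¬q q)

reindex : (Fin n → Fin k) → Model k m → Model n m
reindex f M = record
  { K[_] = K[_] ∘ f ; B[_] = B[_] ∘ f ; I[_] = I[_] ∘ f
  ; K?   = K? ∘ f   ; B?   = B? ∘ f   ; I?   = I? ∘ f
  ; valuation = valuation
  }
  where open Model M

isSModel-reindex : ∀ {M : Model k m} (f : Fin n → Fin k) → IsSModel M → IsSModel (reindex f M)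
isSModel-reindex f isS = record
  { K-refl    = K-refl ∘ f
  ; K-trans   = K-trans ∘ f
  ; B-serial  = B-serial ∘ f
  ; B⊆K       = B⊆K ∘ f
  ; K-B-trans = K-B-trans ∘ f
  ; I-serial  = I-serial ∘ f
  ; K-I-trans = K-I-trans ∘ f
  ; I-K-trans = I-K-trans ∘ f
  ; I-trans   = I-trans ∘ f
  }
  where open IsSModel isS

knows : Fin 2 → Fin 4 → Fin 4 → Bool
knows 0F 0F 1F = true
knows 0F 2F 3F = true
knows 1F 0F 2F = true
knows 1F 1F 3F = true
knows _  w  v  = does (w ≟ v)

believes : Fin 2 → Fin 4 → Fin 4 → Bool
believes _ 0F 0F = false
believes a w  v  = knows a w v

secrecyModel : Model 2 4
secrecyModel = record
  { K[_] = λ a → T ∘₂ knows a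
  ; B[_] = λ a → T ∘₂ believes a
  ; I[_] = λ a → T ∘₂ believes a
  ; K?   = λ a w v → T? (knows a w v)
  ; B?   = λ a w v → T? (believes a w v)
  ; I?   = λ a w v → T? (believes a w v)
  ; valuation = λ _ w → not (does (w ≟ 3F))
  }

secrecyModel-isSModel : IsSModel secrecyModel
secrecyModel-isSModel = record
  { K-refl    = from-yes (all? λ a → reflexive? (K? a))
  ; K-trans   = from-yes (all? λ a → trans? (K? a) (K? a) (K? a))
  ; B-serial  = from-yes (all? λ a → serial? (B? a))
  ; B⊆K       = from-yes (all? λ a → ⊆? (B? a) (K? a))
  ; K-B-trans = from-yes (all? λ a → trans? (K? a) (B? a) (B? a))
  ; I-serial  = from-yes (all? λ a → serial? (I? a))
  ; K-I-trans = from-yes (all? λ a → trans? (K? a) (I? a) (I? a))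
  ; I-K-trans = from-yes (all? λ a → trans? (I? a) (K? a) (I? a))
  ; I-trans   = from-yes (all? λ a → trans? (I? a) (I? a) (I? a))
  }
  where open Model secrecyModel

mutualSecret : let open Semantics secrecyModel in 0F ⊩ S 0F 1F (var 0) × 0F ⊩ S 1F 0F (var 0)
mutualSecret = from-yes (0F ⊩? S 0F 1F (var 0) ×-dec 0F ⊩? S 1F 0F (var 0))
  where open Semantics secrecyModel

proposition12 : (n : ℕ) → n ≥ 2 → (a b : Fin n) → a ≢ b →
    (∃ λ (φ : Fm n) → ¬ ⊢S (S a b φ ⇒ ¬' (S b a φ)))
    × (∃ λ (φ : Fm n) → ¬ ⊢S (S a b φ ⇒ ¬' (K b φ)))
proposition12 n _ a b a≢b =
  (var 0 , ⊬-⇒¬ S[a,b] S[b,a]) , (var 0 , ⊬-⇒¬ S[a,b] (proj₁ S[b,a]))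
  where
  role : Fin n → Fin 2
  role c = if does (c ≟ b) then 1F else 0F

  role-a : role a ≡ 0F
  role-a rewrite dec-false (a ≟ b) a≢b = refl

  role-b : role b ≡ 1F
  role-b rewrite dec-true (b ≟ b) refl = refl

  open Semantics (reindex role secrecyModel)
  open Soundness (isSModel-reindex role secrecyModel-isSModel)
  open Semantics secrecyModel using () renaming (_⊩_ to _⊩₂_)

  -- In the reindexed model agent c uses the relations of role c, so both sides unfold
  -- to the same statement about secrecyModel.
  S[a,b] : 0F ⊩ S a b (var 0)
  S[a,b] = subst₂ (λ x y → 0F ⊩₂ S x y (var 0)) (sym role-a) (sym role-b) (proj₁ mutualSecret)

  S[b,a] : 0F ⊩ S b a (var 0)
  S[b,a] = subst₂ (λ x y → 0F ⊩₂ S x y (var 0)) (sym role-b) (sym role-a) (proj₂ mutualSecret)
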